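{- Let $P=(v_0,\dots,v_\ell)$ be a path of length $\ell\ge1$ and let $s,t\in V(P)$. Then the two-rooted graph $(P,s,t)$ is not inherent if (i) $s=v_0$, $t=v_{\ell-1}$ and $\ell\ge3$; or (ii) $s=t=v_0$ and $\ell\ne2$.
   Context: Graphs are finite, simple and undirected. A two-rooted graph is a triple $(H,s,t)$ with $H$ a graph and $s,t\in V(H)$ not necessarily distinct. A copy of $(\hat H,\hat s,\hat t)$ in $G$ is $(H,s,t)$ with $H$ an induced subgraph of $G$ and an isomorphism $\hat H\to H$ mapping $\hat s\mapsto s$, $\hat t\mapsto t$. An extension of a copy $(H,s,t)$ in $G$ is $(H',s',t')$ with $H'$ an induced subgraph of $G$, $V(H')=V(H)\cup\{s',t'\}$, $s'\ne t'$ not in $V(H)$, $H'-\{s',t'\}=H$, and $s$ (resp. $t$) the unique neighbour of $s'$ (resp. $t'$) in $H'$; it is closable if there is an induced $s',t'$-path in $G$ all of whose internal vertices lie outside $N_G[V(H)]$. A copy is avoidable if all its extensions are closable. $(\hat H,\hat s,\hat t)$ is inherent if every graph containing an induced subgraph isomorphic to $\hat H$ contains an avoidable copy of $(\hat H,\hat s,\hat t)$. -}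

module Defs where

open import Data.Nat using (ℕ; zero; suc; _<_; _≤_; _≡ᵇ_)
open import Data.Fin using (Fin; toℕ; fromℕ; inject₁)
open import Data.Bool using (Bool; true; false; _∨_)
open import Data.Bool.Properties using (∨-comm)
open import Data.Product using (Σ; _×_; _,_)
open import Data.Sum using (_⊎_)
open import Relation.Binary.PropositionalEquality using (_≡_; _≢_; refl; cong₂)
open import Function.Definitions using (Injective)
open import Function.Bundles using (_⇔_)

record Graph : Set where
  field
    n      : ℕ
    adj    : Fin n → Fin n → Bool
    sym    : ∀ x y → adj x y ≡ adj y x
    irrefl : ∀ x → adj x x ≡ false
open Graph public

-- An isomorphism of H onto an induced subgraph of G.  A copy (H,s,t) of (Ĥ,ŝ,t̂)
-- is given by such an embedding e, with s = map e ŝ, t = map e t̂.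
record Embedding (H G : Graph) : Set where
  field
    map       : Fin (n H) → Fin (n G)
    inj       : Injective _≡_ _≡_ map
    preserves : ∀ x y → adj G (map x) (map y) ≡ adj H x y
open Embedding public

record IsExtension {H G : Graph} (e : Embedding H G) (s t s' t' : Fin (n G)) : Set where
  field
    distinct : s' ≢ t'
    s'∉H     : ∀ x → s' ≢ map e x
    t'∉H     : ∀ x → t' ≢ map e x
    s't'     : adj G s' t' ≡ false
    s'nbr    : ∀ x → (adj G s' (map e x) ≡ true) ⇔ (map e x ≡ s)
    t'nbr    : ∀ x → (adj G t' (map e x) ≡ true) ⇔ (map e x ≡ t)

IsInducedPath : (G : Graph) (k : ℕ) → (Fin (suc k) → Fin (n G)) → Set
IsInducedPath G k p =
  Injective _≡_ _≡_ p ×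
  (∀ i j → (adj G (p i) (p j) ≡ true) ⇔ ((toℕ i ≡ suc (toℕ j)) ⊎ (toℕ j ≡ suc (toℕ i))))

Closable : {H G : Graph} (e : Embedding H G) (s' t' : Fin (n G)) → Set
Closable {H} {G} e s' t' =
  Σ ℕ λ k → Σ (Fin (suc k) → Fin (n G)) λ p →
    IsInducedPath G k p × (p Data.Fin.zero ≡ s') × (p (fromℕ k) ≡ t') ×
    (∀ i → 0 < toℕ i → toℕ i < k → ∀ x → (p i ≢ map e x) × (adj G (p i) (map e x) ≡ false))

Avoidable : {H G : Graph} (e : Embedding H G) (s t : Fin (n G)) → Set
Avoidable {H} {G} e s t = ∀ s' t' → IsExtension e s t s' t' → Closable e s' t'

Inherent : (Ĥ : Graph) (ŝ t̂ : Fin (n Ĥ)) → Set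
Inherent Ĥ ŝ t̂ =
  (G : Graph) → Embedding Ĥ G →
  Σ (Embedding Ĥ G) λ e → Avoidable e (map e ŝ) (map e t̂)

pathAdj : (ℓ : ℕ) → Fin (suc ℓ) → Fin (suc ℓ) → Bool
pathAdj ℓ i j = (toℕ i ≡ᵇ suc (toℕ j)) ∨ (toℕ j ≡ᵇ suc (toℕ i))

private
  n≢ᵇsn : ∀ m → (m ≡ᵇ suc m) ≡ false
  n≢ᵇsn zero = refl
  n≢ᵇsn (suc m) = n≢ᵇsn m

  pathIrrefl : ∀ ℓ (i : Fin (suc ℓ)) → pathAdj ℓ i i ≡ false
  pathIrrefl ℓ i with toℕ i
  ... | m rewrite n≢ᵇsn m = refl

Path : ℕ → Graph
Path ℓ = record
  { n = suc ℓ
  ; adj = pathAdj ℓ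
  ; sym = λ i j → ∨-comm (toℕ i ≡ᵇ suc (toℕ j)) (toℕ j ≡ᵇ suc (toℕ i))
  ; irrefl = pathIrrefl ℓ
  }

-- v₀ and v_{ℓ-1} as vertices of Path ℓ (v_{ℓ-1} is only meaningful for ℓ ≥ 1).
v₀ : (ℓ : ℕ) → Fin (suc ℓ)
v₀ ℓ = Data.Fin.zero

vPred : (ℓ : ℕ) → Fin (suc ℓ)
vPred zero = Data.Fin.zero
vPred (suc k) = inject₁ (fromℕ k)

module Submission where

-- Counterexample: G is the cycle C_{ℓ+3} with every vertex blown up into two nonadjacent
-- twins. On an induced path with ℓ ≠ 2 two vertices at distance two are never twins, so the
-- classes of any induced copy of P_ℓ walk around the cycle without backtracking; after a
-- symmetry of the cycle they are 0, 1, …, ℓ, and the classes ℓ+1 and ℓ+2 stay free. A vertex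
-- s′ of class ℓ+2 sees only v₀ in the copy, and each of its neighbours (classes 0 and ℓ+1)
-- sees v₁ or v_ℓ, so the second vertex of any path from s′ lies in N[V(P)]. With t′ the twin
-- of s′ this gives an unclosable extension for s = t = v₀; with t′ the twin of v_ℓ, one for
-- s = v₀, t = v_{ℓ-1}.

open import Defs hiding (sym)
open import Data.Bool using (true; false)
open import Data.Bool.Properties using (¬-not)
open import Data.Empty using (⊥-elim)
open import Data.Fin
  using (Fin; zero; suc; toℕ; fromℕ; fromℕ<; inject₁; opposite; splitAt; join; _↑ˡ_; _↑ʳ_)
open import Data.Fin.Properties
  using (toℕ-injective; toℕ<n; toℕ-fromℕ; toℕ-fromℕ<; toℕ-inject₁; opposite-involutive; opposite-prop;
         splitAt-↑ˡ; splitAt-↑ʳ; splitAt-join; ↑ˡ-injective; inject₁-injective)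
  renaming (_≟_ to _≟ᶠ_)
open import Data.Fin.Permutation
  using (Permutation′; permutation; _⟨$⟩ʳ_; _⟨$⟩ˡ_; inverseˡ; inverseʳ; _∘ₚ_)
  renaming (id to idₚ)
open import Data.Nat using (ℕ; zero; suc; pred; _+_; _∸_; _<_; _≤_; z≤n; s≤s; _≟_)
open import Data.Nat.Properties
  using (1+n≢n; 1+n≢0; <⇒≢; <⇒≤; <-trans; n<1+n; ≤-refl; ≤-pred; ≤-antisym; ≮⇒≥; n∸n≡0;
         m<n⇒0<n∸m; pred[m∸n]≡m∸[1+n]; suc-injective)
open import Data.Product using (Σ; _×_; _,_; proj₁; proj₂)
open import Data.Sum using (_⊎_; inj₁; inj₂; reduce; swap)
open import Function using (_∘_)
open import Function.Bundles using (_⇔_; mk⇔; Equivalence)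
open import Relation.Binary.PropositionalEquality
  using (_≡_; _≢_; refl; sym; trans; cong; cong₂; subst; subst₂; module ≡-Reasoning)
open import Relation.Nullary using (¬_; Dec; yes; no; does)
open import Relation.Nullary.Decidable using (_⊎-dec_; dec-false; does-⇔)

open Equivalence using (to; from)
open ≡-Reasoning

dec-true⇔ : ∀ {P : Set} (p? : Dec P) → does p? ≡ true ⇔ P
dec-true⇔ (yes p) = mk⇔ (λ _ → p) (λ _ → refl)
dec-true⇔ (no ¬p) = mk⇔ (λ ()) (λ p → ⊥-elim (¬p p))

SameNeighbours : (G : Graph) → Fin (n G) → Fin (n G) → Set
SameNeighbours G x y = ∀ z → adj G z x ≡ adj G z y

¬closable : ∀ {H G : Graph} (e : Embedding H G) {s′ t′} → s′ ≢ t′ → adj G s′ t′ ≡ false →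
            (∀ z → adj G s′ z ≡ true → Σ (Fin (n H)) λ x → adj G z (map e x) ≡ true) →
            ¬ Closable e s′ t′
¬closable e s′≢t′ _ _ (zero , p , _ , p₀≡s′ , p₀≡t′ , _) = s′≢t′ (trans (sym p₀≡s′) p₀≡t′)
¬closable e _ s′≁t′ _ (suc zero , p , (_ , p-adj) , refl , refl , _)
  with trans (sym (from (p-adj zero (suc zero)) (inj₂ refl))) s′≁t′
... | ()
¬closable e _ _ s′-nbrs (suc (suc _) , p , (_ , p-adj) , refl , _ , internal)
  with s′-nbrs (p (suc zero)) (from (p-adj zero (suc zero)) (inj₂ refl))
... | x , p₁~x with trans (sym p₁~x) (proj₂ (internal (suc zero) (s≤s z≤n) (s≤s (s≤s z≤n)) x))
...   | ()

¬inherent : ∀ {Ĥ ŝ t̂} (G : Graph) → Embedding Ĥ G →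
            (∀ e → ¬ Avoidable e (map e ŝ) (map e t̂)) → ¬ Inherent Ĥ ŝ t̂
¬inherent G ι unavoidable inherent with inherent G ι
... | e , avoidable = unavoidable e avoidable

Consecutive : ℕ → ℕ → Set
Consecutive a b = a ≡ suc b ⊎ b ≡ suc a

consecutive? : ∀ a b → Dec (Consecutive a b)
consecutive? a b = (a ≟ suc b) ⊎-dec (b ≟ suc a)

middle-of-consecutive : ∀ {a c} → Consecutive c a → Consecutive c (2 + a) → c ≡ suc a
middle-of-consecutive (inj₁ c≡1+a) _ = c≡1+a
middle-of-consecutive (inj₂ refl) (inj₁ ())
middle-of-consecutive (inj₂ refl) (inj₂ ())

pathAdj⇔Consecutive : ∀ {ℓ} (i j : Fin (suc ℓ)) →
                      pathAdj ℓ i j ≡ true ⇔ Consecutive (toℕ i) (toℕ j)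
pathAdj⇔Consecutive i j = dec-true⇔ (consecutive? (toℕ i) (toℕ j))

pathAdj-last⇔ : ∀ {L} (x : Fin (2 + L)) →
                pathAdj (suc L) (fromℕ (suc L)) x ≡ true ⇔ x ≡ vPred (suc L)
pathAdj-last⇔ {L} x = mk⇔ forward backward
  where
  toℕ-vPred : toℕ (vPred (suc L)) ≡ L
  toℕ-vPred = trans (toℕ-inject₁ (fromℕ L)) (toℕ-fromℕ L)
  forward : pathAdj (suc L) (fromℕ (suc L)) x ≡ true → x ≡ vPred (suc L)
  forward last~x with to (pathAdj⇔Consecutive (fromℕ (suc L)) x) last~x
  ... | inj₁ last≡1+x =
    toℕ-injective (trans (suc-injective (trans (sym last≡1+x) (toℕ-fromℕ (suc L)))) (sym toℕ-vPred))
  ... | inj₂ x≡1+last = ⊥-elim (<⇒≢ (toℕ<n x) (trans x≡1+last (cong suc (toℕ-fromℕ (suc L)))))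
  backward : x ≡ vPred (suc L) → pathAdj (suc L) (fromℕ (suc L)) x ≡ true
  backward refl = from (pathAdj⇔Consecutive (fromℕ (suc L)) x)
    (inj₁ (trans (toℕ-fromℕ (suc L)) (cong suc (sym toℕ-vPred))))

module _ {ℓ} {i j : Fin (suc ℓ)} (same : SameNeighbours (Path ℓ) i j) (j≡2+i : toℕ j ≡ 2 + toℕ i)
  where

  path-common-neighbour : ∀ z → pathAdj ℓ z i ≡ true → toℕ z ≡ suc (toℕ i)
  path-common-neighbour z zi = middle-of-consecutive (to (pathAdj⇔Consecutive z i) zi)
    (subst (Consecutive (toℕ z)) j≡2+i (to (pathAdj⇔Consecutive z j) (trans (sym (same z)) zi)))

  path-twins-end-at-last : ¬ (3 + toℕ i < suc ℓ)
  path-twins-end-at-last 3+i<1+ℓ = <⇒≢ (<-trans (n<1+n _) (n<1+n _))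
    (trans (sym (path-common-neighbour z (trans (same z) zj))) (toℕ-fromℕ< 3+i<1+ℓ))
    where
    z = fromℕ< 3+i<1+ℓ
    zj : pathAdj ℓ z j ≡ true
    zj = from (pathAdj⇔Consecutive z j)
      (inj₁ (trans (toℕ-fromℕ< 3+i<1+ℓ) (cong suc (sym j≡2+i))))

path-twins-start-at-first : ∀ {ℓ} {i j : Fin (suc ℓ)} → SameNeighbours (Path ℓ) i j →
                            toℕ j ≡ 2 + toℕ i → i ≡ zero
path-twins-start-at-first {i = zero} _ _ = refl
path-twins-start-at-first {ℓ} {i = suc i′} same j≡2+i =
  ⊥-elim (<⇒≢ (<-trans (n<1+n _) (n<1+n _))
    (trans (sym (toℕ-inject₁ i′)) (path-common-neighbour same j≡2+i (inject₁ i′) zi)))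
  where
  zi : pathAdj ℓ (inject₁ i′) (suc i′) ≡ true
  zi = from (pathAdj⇔Consecutive (inject₁ i′) (suc i′)) (inj₂ (cong suc (sym (toℕ-inject₁ i′))))

path-no-twins-at-distance-two : ∀ {ℓ} → ℓ ≢ 2 → (i j : Fin (suc ℓ)) → toℕ j ≡ 2 + toℕ i →
                                ¬ SameNeighbours (Path ℓ) i j
path-no-twins-at-distance-two {ℓ} ℓ≢2 i j j≡2+i same = ℓ≢2 (≤-antisym ℓ≤2 2≤ℓ)
  where
  i≡0 = path-twins-start-at-first same j≡2+i
  ℓ≤2 : ℓ ≤ 2
  ℓ≤2 = ≤-pred (≮⇒≥ (subst (λ i → ¬ (3 + toℕ i < suc ℓ)) i≡0 (path-twins-end-at-last same j≡2+i)))
  2≤ℓ : 2 ≤ ℓ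
  2≤ℓ = ≤-pred (subst (_< suc ℓ) (trans j≡2+i (cong (λ i → 2 + toℕ i) i≡0)) (toℕ<n j))

-- Reading Fin m as ℤ/m: opposite a = -1 - a, negate a = -a and prev a = a - 1. Any two
-- involutions r₁, r₂ reverse r₁ ∘ r₂, so both reflections are automorphisms of the cycle.
negate : ∀ {m} → Fin m → Fin m
negate zero    = zero
negate (suc i) = suc (opposite i)

negate-involutive : ∀ {m} (a : Fin m) → negate (negate a) ≡ a
negate-involutive zero    = refl
negate-involutive (suc i) = cong suc (opposite-involutive i)

prev : ∀ {m} → Fin m → Fin m
prev = opposite ∘ negate

infix 4 _~_
_~_ : ∀ {m} → Fin m → Fin m → Set
a ~ b = a ≡ prev b ⊎ b ≡ prev a

~-sym : ∀ {m} {a b : Fin m} → a ~ b → b ~ a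
~-sym = swap

_~?_ : ∀ {m} (a b : Fin m) → Dec (a ~ b)
a ~? b = (a ≟ᶠ prev b) ⊎-dec (b ≟ᶠ prev a)

module _ {A : Set} (r₁ r₂ : A → A) (r₁-inv : ∀ a → r₁ (r₁ a) ≡ a) (r₂-inv : ∀ a → r₂ (r₂ a) ≡ a)
  where

  reflection₁-reverses : ∀ {a b} → a ≡ r₁ (r₂ b) → r₁ b ≡ r₁ (r₂ (r₁ a))
  reflection₁-reverses {b = b} refl = cong r₁ (begin
    b                   ≡⟨ r₂-inv b ⟨
    r₂ (r₂ b)           ≡⟨ cong r₂ (r₁-inv (r₂ b)) ⟨
    r₂ (r₁ (r₁ (r₂ b))) ∎)

  reflection₂-reverses : ∀ {a b} → a ≡ r₁ (r₂ b) → r₂ b ≡ r₁ (r₂ (r₂ a))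
  reflection₂-reverses {b = b} refl = begin
    r₂ b                     ≡⟨ r₁-inv (r₂ b) ⟨
    r₁ (r₁ (r₂ b))           ≡⟨ cong r₁ (r₂-inv (r₁ (r₂ b))) ⟨
    r₁ (r₂ (r₂ (r₁ (r₂ b)))) ∎

record CycleAutomorphism (m : ℕ) : Set where
  field
    perm        : Permutation′ m
    preserves-~ : ∀ {a b} → a ~ b → perm ⟨$⟩ʳ a ~ perm ⟨$⟩ʳ b
    reflects-~  : ∀ {a b} → perm ⟨$⟩ʳ a ~ perm ⟨$⟩ʳ b → a ~ b
open CycleAutomorphism

infixl 9 _⟨$⟩_
_⟨$⟩_ : ∀ {m} → CycleAutomorphism m → Fin m → Fin m
β ⟨$⟩ a = perm β ⟨$⟩ʳ a

⟨$⟩-injective : ∀ {m} (β : CycleAutomorphism m) {a b} → β ⟨$⟩ a ≡ β ⟨$⟩ b → a ≡ b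
⟨$⟩-injective β {a} {b} βa≡βb = begin
  a                     ≡⟨ inverseˡ (perm β) ⟨
  perm β ⟨$⟩ˡ (β ⟨$⟩ a) ≡⟨ cong (perm β ⟨$⟩ˡ_) βa≡βb ⟩
  perm β ⟨$⟩ˡ (β ⟨$⟩ b) ≡⟨ inverseˡ (perm β) ⟩
  b                     ∎

identityᴬ : ∀ {m} → CycleAutomorphism m
identityᴬ = record { perm = idₚ ; preserves-~ = λ a~b → a~b ; reflects-~ = λ a~b → a~b }

-- Diagrammatic order, as for _∘ₚ_.
infixr 9 _∘ᴬ_
_∘ᴬ_ : ∀ {m} → CycleAutomorphism m → CycleAutomorphism m → CycleAutomorphism m
α ∘ᴬ β = record
  { perm        = perm α ∘ₚ perm β
  ; preserves-~ = preserves-~ β ∘ preserves-~ α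
  ; reflects-~  = reflects-~ α ∘ reflects-~ β
  }

reflection : ∀ {m} (r : Fin m → Fin m) → (∀ a → r (r a) ≡ a) →
             (∀ {a b} → a ≡ prev b → r b ≡ prev (r a)) → CycleAutomorphism m
reflection r r-inv reverses = record
  { perm        = permutation r r r-inv r-inv
  ; preserves-~ = r-preserves
  ; reflects-~  = λ {a} {b} ra~rb → subst₂ _~_ (r-inv a) (r-inv b) (r-preserves ra~rb)
  }
  where
  r-preserves : ∀ {a b} → a ~ b → r a ~ r b
  r-preserves (inj₁ a≡prev-b) = inj₂ (reverses a≡prev-b)
  r-preserves (inj₂ b≡prev-a) = inj₁ (reverses b≡prev-a)

opposite-reflection : ∀ {m} → CycleAutomorphism m
opposite-reflection = reflection opposite opposite-involutive
  (reflection₁-reverses opposite negate opposite-involutive negate-involutive)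

negate-reflection : ∀ {m} → CycleAutomorphism m
negate-reflection = reflection negate negate-involutive
  (reflection₂-reverses opposite negate opposite-involutive negate-involutive)

rotation : ∀ {m} → ℕ → CycleAutomorphism m
rotation zero    = identityᴬ
rotation (suc r) = rotation r ∘ᴬ negate-reflection ∘ᴬ opposite-reflection

Succ : ∀ {k} → Fin (suc k) → Fin (suc k) → Set
Succ {k} a b = toℕ b ≡ suc (toℕ a) ⊎ (toℕ a ≡ k × toℕ b ≡ 0)

toℕ-prev-suc : ∀ {k} (i : Fin k) → toℕ (prev (suc i)) ≡ toℕ i
toℕ-prev-suc i = trans (toℕ-inject₁ (opposite (opposite i))) (cong toℕ (opposite-involutive i))

≡prev⇔Succ : ∀ {k} {a b : Fin (suc k)} → a ≡ prev b ⇔ Succ a b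
≡prev⇔Succ {k} {a} {b} = mk⇔ (forward b) (backward b)
  where
  forward : ∀ b → a ≡ prev b → Succ a b
  forward zero    refl = inj₂ (toℕ-fromℕ k , refl)
  forward (suc i) refl = inj₁ (cong suc (sym (toℕ-prev-suc i)))
  backward : ∀ b → Succ a b → a ≡ prev b
  backward zero    (inj₂ (a≡k , _)) = toℕ-injective (trans a≡k (sym (toℕ-fromℕ k)))
  backward (suc i) (inj₁ 1+i≡1+a)   =
    toℕ-injective (trans (sym (suc-injective 1+i≡1+a)) (sym (toℕ-prev-suc i)))

~⇔Succ : ∀ {k} {a b : Fin (suc k)} → a ~ b ⇔ (Succ a b ⊎ Succ b a)
~⇔Succ = mk⇔ (Data.Sum.map (to ≡prev⇔Succ) (to ≡prev⇔Succ))
             (Data.Sum.map (from ≡prev⇔Succ) (from ≡prev⇔Succ))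

successor-adjacent : ∀ {k} {a b : Fin (suc k)} → toℕ b ≡ suc (toℕ a) → a ~ b
successor-adjacent b≡1+a = inj₁ (from ≡prev⇔Succ (inj₁ b≡1+a))

~-irrefl : ∀ {k} (a : Fin (suc (suc k))) → ¬ a ~ a
~-irrefl a a~a = Succ-irrefl (reduce (to ~⇔Succ a~a))
  where
  Succ-irrefl : ¬ Succ a a
  Succ-irrefl (inj₁ a≡1+a)       = 1+n≢n (sym a≡1+a)
  Succ-irrefl (inj₂ (a≡k , a≡0)) = 1+n≢0 (trans (sym a≡k) a≡0)

fromℕ-neighbours : ∀ {k} {b : Fin (suc k)} → fromℕ k ~ b → toℕ b ≡ 0 ⊎ suc (toℕ b) ≡ k
fromℕ-neighbours {k} {b} fromℕ~b with to ~⇔Succ fromℕ~b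
... | inj₁ (inj₁ b≡1+k)       = ⊥-elim (<⇒≢ (toℕ<n b) (trans b≡1+k (cong suc (toℕ-fromℕ k))))
... | inj₁ (inj₂ (_ , b≡0))   = inj₁ b≡0
... | inj₂ (inj₁ k≡1+b)       = inj₂ (trans (sym k≡1+b) (toℕ-fromℕ k))
... | inj₂ (inj₂ (b≡k , k≡0)) = inj₁ (trans b≡k (trans (sym (toℕ-fromℕ k)) k≡0))

~⇔Consecutive : ∀ {k} {a b : Fin (suc k)} → toℕ a < k → toℕ b < k →
                a ~ b ⇔ Consecutive (toℕ a) (toℕ b)
~⇔Consecutive {k} {a} {b} a<k b<k = mk⇔ forward backward
  where
  forward : a ~ b → Consecutive (toℕ a) (toℕ b)
  forward a~b with to ~⇔Succ a~b
  ... | inj₁ (inj₁ b≡1+a)       = inj₂ b≡1+a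
  ... | inj₁ (inj₂ (a≡k , _))   = ⊥-elim (<⇒≢ a<k a≡k)
  ... | inj₂ (inj₁ a≡1+b)       = inj₁ a≡1+b
  ... | inj₂ (inj₂ (b≡k , _))   = ⊥-elim (<⇒≢ b<k b≡k)
  backward : Consecutive (toℕ a) (toℕ b) → a ~ b
  backward (inj₁ a≡1+b) = ~-sym (successor-adjacent a≡1+b)
  backward (inj₂ b≡1+a) = successor-adjacent b≡1+a

toℕ-rotation : ∀ {k} r (a : Fin (suc k)) → r ≤ toℕ a → toℕ (rotation r ⟨$⟩ a) ≡ toℕ a ∸ r
toℕ-rotation zero    a _    = refl
toℕ-rotation (suc r) a r<a with rotation r ⟨$⟩ a | toℕ-rotation r a (<⇒≤ r<a)
... | zero  | 0≡a∸r = ⊥-elim (<⇒≢ (m<n⇒0<n∸m r<a) 0≡a∸r)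
... | suc i | 1+i≡a∸r = begin
  toℕ (prev (suc i)) ≡⟨ toℕ-prev-suc i ⟩
  toℕ i              ≡⟨ cong pred 1+i≡a∸r ⟩
  pred (toℕ a ∸ r)   ≡⟨ pred[m∸n]≡m∸[1+n] (toℕ a) r ⟩
  toℕ a ∸ suc r      ∎

rotation-to-zero : ∀ {k} (a : Fin (suc k)) → rotation (toℕ a) ⟨$⟩ a ≡ zero
rotation-to-zero a = toℕ-injective (trans (toℕ-rotation (toℕ a) a ≤-refl) (n∸n≡0 (toℕ a)))

normalise : ∀ {k} {a b : Fin (suc (suc k))} → a ~ b →
            Σ (CycleAutomorphism (suc (suc k))) λ β → β ⟨$⟩ a ≡ zero × toℕ (β ⟨$⟩ b) ≡ 1
normalise {k} {a} {b} a~b = orient (subst (_~ ρ ⟨$⟩ b) (rotation-to-zero a) (preserves-~ ρ a~b))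
  where
  ρ = rotation (toℕ a)
  orient : zero ~ ρ ⟨$⟩ b →
           Σ (CycleAutomorphism (suc (suc k))) λ β → β ⟨$⟩ a ≡ zero × toℕ (β ⟨$⟩ b) ≡ 1
  orient (inj₁ 0≡prev-ρb) with to ≡prev⇔Succ 0≡prev-ρb
  ... | inj₁ ρb≡1 = ρ , rotation-to-zero a , ρb≡1
  orient (inj₂ ρb≡prev-0) = ρ ∘ᴬ negate-reflection , cong negate (rotation-to-zero a) , (begin
    toℕ (negate (ρ ⟨$⟩ b))         ≡⟨ cong (toℕ ∘ negate) ρb≡prev-0 ⟩
    suc (toℕ (opposite (fromℕ k))) ≡⟨ cong suc (opposite-prop (fromℕ k)) ⟩
    suc (k ∸ toℕ (fromℕ k))        ≡⟨ cong (λ x → suc (k ∸ x)) (toℕ-fromℕ k) ⟩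
    suc (k ∸ k)                    ≡⟨ cong suc (n∸n≡0 k) ⟩
    1                              ∎)

nonbacktracking-walk-position : ∀ {ℓ k} → ℓ < k → (w : Fin (suc ℓ) → Fin (suc k)) →
  (∀ i j → toℕ i ≡ suc (toℕ j) → w i ~ w j) →
  (∀ i j → toℕ j ≡ 2 + toℕ i → w i ≢ w j) →
  (∀ i → toℕ i ≤ 1 → toℕ (w i) ≡ toℕ i) →
  ∀ i → toℕ (w i) ≡ toℕ i
nonbacktracking-walk-position {ℓ} {k} ℓ<k w w-adjacent w-nonbacktracking w-start i =
  proj₁ (positions (toℕ i)) i refl
  where
  Positioned : ℕ → Set
  Positioned d = ∀ i → toℕ i ≡ d → toℕ (w i) ≡ d

  start : ∀ d → d ≤ 1 → Positioned d
  start d d≤1 i refl = w-start i d≤1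

  step : ∀ d → Positioned d → Positioned (suc d) → Positioned (2 + d)
  step d at-d at-1+d i i≡2+d =
    conclude (to ~⇔Succ (w-adjacent i i₁ (trans i≡2+d (cong suc (sym toℕ-i₁)))))
    where
    2+d<1+ℓ : 2 + d < suc ℓ
    2+d<1+ℓ = subst (_< suc ℓ) i≡2+d (toℕ<n i)
    1+d<1+ℓ = <-trans (n<1+n _) 2+d<1+ℓ
    d<1+ℓ   = <-trans (n<1+n _) 1+d<1+ℓ
    i₁ = fromℕ< 1+d<1+ℓ
    i₀ = fromℕ< d<1+ℓ
    toℕ-i₁ : toℕ i₁ ≡ suc d
    toℕ-i₁ = toℕ-fromℕ< 1+d<1+ℓ
    w-i₁ : toℕ (w i₁) ≡ suc d
    w-i₁ = at-1+d i₁ toℕ-i₁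
    conclude : Succ (w i) (w i₁) ⊎ Succ (w i₁) (w i) → toℕ (w i) ≡ 2 + d
    conclude (inj₁ (inj₁ wi₁≡1+wi)) = ⊥-elim (w-nonbacktracking i₀ i
      (trans i≡2+d (cong (2 +_) (sym (toℕ-fromℕ< d<1+ℓ))))
      (toℕ-injective (trans (at-d i₀ (toℕ-fromℕ< d<1+ℓ))
                            (suc-injective (trans (sym w-i₁) wi₁≡1+wi)))))
    conclude (inj₁ (inj₂ (_ , wi₁≡0)))  = ⊥-elim (1+n≢0 (trans (sym w-i₁) wi₁≡0))
    conclude (inj₂ (inj₁ wi≡1+wi₁))     = trans wi≡1+wi₁ (cong suc w-i₁)
    conclude (inj₂ (inj₂ (wi₁≡k , _)))  =
      ⊥-elim (<⇒≢ (<-trans (≤-pred 2+d<1+ℓ) ℓ<k) (trans (sym w-i₁) wi₁≡k))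

  positions : ∀ d → Positioned d × Positioned (suc d)
  positions zero    = start 0 z≤n , start 1 (s≤s z≤n)
  positions (suc d) with positions d
  ... | at-d , at-1+d = at-1+d , step d at-d at-1+d

-- A vertex of Fin (m + m) is one of the two copies a ↑ˡ m and m ↑ʳ a of a class a : Fin m.
module _ {m : ℕ} where

  class : Fin (m + m) → Fin m
  class = reduce ∘ splitAt m

  twin : Fin (m + m) → Fin (m + m)
  twin = join m m ∘ swap ∘ splitAt m

  class-↑ˡ : ∀ a → class (a ↑ˡ m) ≡ a
  class-↑ˡ a = cong reduce (splitAt-↑ˡ m a m)

  class-↑ʳ : ∀ a → class (m ↑ʳ a) ≡ a
  class-↑ʳ a = cong reduce (splitAt-↑ʳ m m a)

  ↑ˡ≢↑ʳ : ∀ a b → a ↑ˡ m ≢ m ↑ʳ b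
  ↑ˡ≢↑ʳ a b eq with trans (sym (splitAt-↑ˡ m a m)) (trans (cong (splitAt m) eq) (splitAt-↑ʳ m m b))
  ... | ()

  class-twin : ∀ x → class (twin x) ≡ class x
  class-twin x =
    trans (cong reduce (splitAt-join m m (swap (splitAt m x)))) (reduce-swap (splitAt m x))
    where
    reduce-swap : ∀ (s : Fin m ⊎ Fin m) → reduce (swap s) ≡ reduce s
    reduce-swap (inj₁ _) = refl
    reduce-swap (inj₂ _) = refl

  twin-≢ : ∀ x → twin x ≢ x
  twin-≢ x eq =
    swap-≢ (splitAt m x) (trans (sym (splitAt-join m m (swap (splitAt m x)))) (cong (splitAt m) eq))
    where
    swap-≢ : ∀ (s : Fin m ⊎ Fin m) → swap s ≢ s
    swap-≢ (inj₁ _) ()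
    swap-≢ (inj₂ _) ()

BlownUpCycle : ℕ → Graph
BlownUpCycle k = record
  { n      = m + m
  ; adj    = λ x y → does (class {m} x ~? class y)
  ; sym    = λ x y → does-⇔ (mk⇔ ~-sym ~-sym) (class {m} x ~? class y) (class y ~? class x)
  ; irrefl = λ x → dec-false (class {m} x ~? class x) (~-irrefl (class x))
  }
  where
  m = suc (suc k)

module _ {k : ℕ} where

  adj⇔~ : ∀ x y → adj (BlownUpCycle k) x y ≡ true ⇔ class {suc (suc k)} x ~ class y
  adj⇔~ x y = dec-true⇔ (class x ~? class y)

  adj≡does : ∀ x y {a b} → class {suc (suc k)} x ≡ a → class {suc (suc k)} y ≡ b →
             adj (BlownUpCycle k) x y ≡ does (a ~? b)
  adj≡does _ _ = cong₂ λ a b → does (a ~? b)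

pathIntoBlownUpCycle : ∀ ℓ → Embedding (Path ℓ) (BlownUpCycle (suc ℓ))
pathIntoBlownUpCycle ℓ = record
  { map       = λ i → ι i ↑ˡ _
  ; inj       = λ {i} {j} eq → inject₁-injective (inject₁-injective (↑ˡ-injective _ (ι i) (ι j) eq))
  ; preserves = λ i j → trans (adj≡does (ι i ↑ˡ _) (ι j ↑ˡ _) (class-↑ˡ (ι i)) (class-↑ˡ (ι j)))
                              (does-⇔ (ι-adjacent i j) (ι i ~? ι j) (consecutive? (toℕ i) (toℕ j)))
  }
  where
  ι : Fin (suc ℓ) → Fin (suc (suc (suc ℓ)))
  ι = inject₁ ∘ inject₁
  toℕ-ι : ∀ i → toℕ (ι i) ≡ toℕ i
  toℕ-ι i = trans (toℕ-inject₁ (inject₁ i)) (toℕ-inject₁ i)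
  ι<2+ℓ : ∀ i → toℕ (ι i) < suc (suc ℓ)
  ι<2+ℓ i = subst (_< _) (sym (toℕ-ι i)) (<-trans (toℕ<n i) (n<1+n _))
  ι-adjacent : ∀ i j → ι i ~ ι j ⇔ Consecutive (toℕ i) (toℕ j)
  ι-adjacent i j = subst₂ (λ a b → ι i ~ ι j ⇔ Consecutive a b) (toℕ-ι i) (toℕ-ι j)
                          (~⇔Consecutive (ι<2+ℓ i) (ι<2+ℓ j))

module CopyOfPath {L : ℕ} (ℓ≢2 : suc L ≢ 2) (e : Embedding (Path (suc L)) (BlownUpCycle (suc (suc L))))
  where

  private
    ℓ : ℕ
    ℓ = suc L
    G : Graph
    G = BlownUpCycle (suc ℓ)
    m : ℕ
    m = 3 + ℓ
    apex : Fin m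
    apex = fromℕ (2 + ℓ)

  pathClass : Fin (suc ℓ) → Fin m
  pathClass = class ∘ map e

  pathClass-adjacent : ∀ i j → toℕ i ≡ suc (toℕ j) → pathClass i ~ pathClass j
  pathClass-adjacent i j i≡1+j = to (adj⇔~ (map e i) (map e j))
    (trans (preserves e i j) (from (pathAdj⇔Consecutive i j) (inj₁ i≡1+j)))

  pathClass-nonbacktracking : ∀ i j → toℕ j ≡ 2 + toℕ i → pathClass i ≢ pathClass j
  pathClass-nonbacktracking i j j≡2+i ci≡cj = path-no-twins-at-distance-two ℓ≢2 i j j≡2+i λ z → begin
    pathAdj ℓ z i             ≡⟨ preserves e z i ⟨
    adj G (map e z) (map e i) ≡⟨ adj≡does (map e z) (map e i) refl ci≡cj ⟩
    adj G (map e z) (map e j) ≡⟨ preserves e z j ⟩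
    pathAdj ℓ z j             ∎

  normalisation : Σ (CycleAutomorphism m) λ β →
                  β ⟨$⟩ pathClass zero ≡ zero × toℕ (β ⟨$⟩ pathClass (suc zero)) ≡ 1
  normalisation = normalise (~-sym (pathClass-adjacent (suc zero) zero refl))

  β : CycleAutomorphism m
  β = proj₁ normalisation

  position : Fin (n G) → Fin m
  position x = β ⟨$⟩ class x

  position-v₀ : position (map e zero) ≡ zero
  position-v₀ = proj₁ (proj₂ normalisation)

  toℕ-position-copy : ∀ i → toℕ (position (map e i)) ≡ toℕ i
  toℕ-position-copy =
    nonbacktracking-walk-position (<-trans (n<1+n _) (n<1+n _)) (position ∘ map e)
      (λ i j i≡1+j → preserves-~ β (pathClass-adjacent i j i≡1+j))
      (λ i j j≡2+i pi≡pj → pathClass-nonbacktracking i j j≡2+i (⟨$⟩-injective β pi≡pj))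
      start
    where
    start : ∀ i → toℕ i ≤ 1 → toℕ (position (map e i)) ≡ toℕ i
    start zero          _           = cong toℕ position-v₀
    start (suc zero)    _           = proj₂ (proj₂ normalisation)
    start (suc (suc _)) (s≤s ())

  adj⇔position : ∀ x y → adj G x y ≡ true ⇔ position x ~ position y
  adj⇔position x y = mk⇔ (preserves-~ β ∘ to (adj⇔~ x y)) (from (adj⇔~ x y) ∘ reflects-~ β)

  -- The copy occupies the positions 0, …, ℓ; the apex position 2 + ℓ is adjacent only to 0
  -- and to the free position 1 + ℓ.
  IsApex : Fin (n G) → Set
  IsApex y = position y ≡ apex

  copy-not-apex : ∀ x → position (map e x) ≢ apex
  copy-not-apex x eq =
    <⇒≢ (<-trans (toℕ<n x) (n<1+n _))
        (trans (sym (toℕ-position-copy x)) (trans (cong toℕ eq) (toℕ-fromℕ _)))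

  apex∉copy : ∀ y → IsApex y → ∀ x → y ≢ map e x
  apex∉copy y y-apex x refl = copy-not-apex x y-apex

  apex-neighbours-in-copy : ∀ y → IsApex y → ∀ x →
                            (adj G y (map e x) ≡ true) ⇔ (map e x ≡ map e zero)
  apex-neighbours-in-copy y y-apex x = mk⇔ forward backward
    where
    forward : adj G y (map e x) ≡ true → map e x ≡ map e zero
    forward y~x
      with fromℕ-neighbours (subst (_~ position (map e x)) y-apex (to (adj⇔position y (map e x)) y~x))
    ... | inj₁ x≡0     = cong (map e) (toℕ-injective (trans (sym (toℕ-position-copy x)) x≡0))
    ... | inj₂ 1+x≡2+ℓ =
      ⊥-elim (<⇒≢ (toℕ<n x) (suc-injective (trans (cong suc (sym (toℕ-position-copy x))) 1+x≡2+ℓ)))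
    backward : map e x ≡ map e zero → adj G y (map e x) ≡ true
    backward ex≡e0 = from (adj⇔position y (map e x))
      (inj₁ (trans y-apex (sym (cong prev (trans (cong position ex≡e0) position-v₀)))))

  apex-neighbours-touch-copy : ∀ y → IsApex y → ∀ z → adj G y z ≡ true →
                               Σ (Fin (suc ℓ)) λ x → adj G z (map e x) ≡ true
  apex-neighbours-touch-copy y y-apex z y~z
    with fromℕ-neighbours (subst (_~ position z) y-apex (to (adj⇔position y z) y~z))
  ... | inj₁ z≡0 = suc zero , from (adj⇔position z (map e (suc zero)))
    (successor-adjacent (trans (toℕ-position-copy (suc zero)) (cong suc (sym z≡0))))
  ... | inj₂ 1+z≡2+ℓ = fromℕ ℓ , from (adj⇔position z (map e (fromℕ ℓ)))
    (~-sym (successor-adjacent (trans (suc-injective 1+z≡2+ℓ)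
      (cong suc (sym (trans (toℕ-position-copy (fromℕ ℓ)) (toℕ-fromℕ ℓ)))))))

  ¬avoidable-via-apex : ∀ {s t} s′ {t′} → IsApex s′ → IsExtension e s t s′ t′ → ¬ Avoidable e s t
  ¬avoidable-via-apex s′ s′-apex ext avoidable =
    ¬closable e (IsExtension.distinct ext) (IsExtension.s't' ext) (apex-neighbours-touch-copy s′ s′-apex)
      (avoidable _ _ ext)

  apexClass : Fin m
  apexClass = perm β ⟨$⟩ˡ apex

  apex₀ apex₁ : Fin (n G)
  apex₀ = apexClass ↑ˡ m
  apex₁ = m ↑ʳ apexClass

  apex₀-isApex : IsApex apex₀
  apex₀-isApex = trans (cong (β ⟨$⟩_) (class-↑ˡ apexClass)) (inverseʳ (perm β))

  apex₁-isApex : IsApex apex₁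
  apex₁-isApex = trans (cong (β ⟨$⟩_) (class-↑ʳ apexClass)) (inverseʳ (perm β))

  apex-twins-extension : IsExtension e (map e zero) (map e zero) apex₀ apex₁
  apex-twins-extension = record
    { distinct = ↑ˡ≢↑ʳ apexClass apexClass
    ; s'∉H     = apex∉copy apex₀ apex₀-isApex
    ; t'∉H     = apex∉copy apex₁ apex₁-isApex
    ; s't'     = trans (adj≡does {suc ℓ} apex₀ apex₁ (class-↑ˡ apexClass) (class-↑ʳ apexClass))
                       (dec-false (apexClass ~? apexClass) (~-irrefl apexClass))
    ; s'nbr    = apex-neighbours-in-copy apex₀ apex₀-isApex
    ; t'nbr    = apex-neighbours-in-copy apex₁ apex₁-isApex
    }

  lastTwin : Fin (n G)
  lastTwin = twin {m} (map e (fromℕ ℓ))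

  position-lastTwin : position lastTwin ≡ position (map e (fromℕ ℓ))
  position-lastTwin = cong (β ⟨$⟩_) (class-twin {m} (map e (fromℕ ℓ)))

  lastTwin-neighbours : ∀ x → adj G lastTwin (map e x) ≡ pathAdj ℓ (fromℕ ℓ) x
  lastTwin-neighbours x =
    trans (adj≡does {suc ℓ} lastTwin (map e x) (class-twin {m} (map e (fromℕ ℓ))) refl)
          (preserves e (fromℕ ℓ) x)

  apex-lastTwin-extension : IsExtension e (map e zero) (map e (vPred ℓ)) apex₀ lastTwin
  apex-lastTwin-extension = record
    { distinct = λ apex₀≡lastTwin → copy-not-apex (fromℕ ℓ)
        (trans (sym position-lastTwin) (trans (cong position (sym apex₀≡lastTwin)) apex₀-isApex))
    ; s'∉H     = apex∉copy apex₀ apex₀-isApex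
    ; t'∉H     = λ x lastTwin≡ex → twin-≢ {m} (map e (fromℕ ℓ))
        (trans lastTwin≡ex (cong (map e) (toℕ-injective (begin
        toℕ x                            ≡⟨ toℕ-position-copy x ⟨
        toℕ (position (map e x))         ≡⟨ cong (toℕ ∘ position) lastTwin≡ex ⟨
        toℕ (position lastTwin)          ≡⟨ cong toℕ position-lastTwin ⟩
        toℕ (position (map e (fromℕ ℓ))) ≡⟨ toℕ-position-copy (fromℕ ℓ) ⟩
        toℕ (fromℕ ℓ)                    ∎))))
    ; s't'     = trans (adj≡does {suc ℓ} apex₀ lastTwin refl (class-twin {m} (map e (fromℕ ℓ))))
                       (¬-not λ apex₀~eℓ → last≢first
                         (inj e (to (apex-neighbours-in-copy apex₀ apex₀-isApex (fromℕ ℓ)) apex₀~eℓ)))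
    ; s'nbr    = apex-neighbours-in-copy apex₀ apex₀-isApex
    ; t'nbr    = λ x → mk⇔
        (λ lastTwin~ex →
          cong (map e) (to (pathAdj-last⇔ x) (trans (sym (lastTwin-neighbours x)) lastTwin~ex)))
        (λ ex≡eL → trans (lastTwin-neighbours x) (from (pathAdj-last⇔ x) (inj e ex≡eL)))
    }
    where
    last≢first : fromℕ ℓ ≢ zero
    last≢first ()

lemma4p3 : (∀ (ℓ : ℕ) → 3 ≤ ℓ → ¬ Inherent (Path ℓ) (v₀ ℓ) (vPred ℓ))
           × (∀ (ℓ : ℕ) → 1 ≤ ℓ → ℓ ≢ 2 → ¬ Inherent (Path ℓ) (v₀ ℓ) (v₀ ℓ))
lemma4p3 = root-and-penultimate , equal-roots
  where
  root-and-penultimate : ∀ ℓ → 3 ≤ ℓ → ¬ Inherent (Path ℓ) (v₀ ℓ) (vPred ℓ)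
  root-and-penultimate (suc (suc (suc L))) (s≤s (s≤s (s≤s _))) =
    ¬inherent _ (pathIntoBlownUpCycle _) λ e →
      let open CopyOfPath {suc (suc L)} (λ ()) e in
      ¬avoidable-via-apex apex₀ apex₀-isApex apex-lastTwin-extension

  equal-roots : ∀ ℓ → 1 ≤ ℓ → ℓ ≢ 2 → ¬ Inherent (Path ℓ) (v₀ ℓ) (v₀ ℓ)
  equal-roots (suc L) _ ℓ≢2 =
    ¬inherent _ (pathIntoBlownUpCycle _) λ e →
      let open CopyOfPath ℓ≢2 e in
      ¬avoidable-via-apex apex₀ apex₀-isApex apex-twins-extension
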